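{- Let $\mathbf B$ be an involutive bisemilattice, identified with its Płonka sum representation over the semilattice direct system $\langle\{\mathbf A_i\}_{i\in I},I,p_{ij}\rangle$ of Boolean algebras, and let $s$ be a state over $\mathbf B$. Then: (1) $s(0)=0$; (2) $s(1_i)=1$ and $s(0_i)=0$ for every $i\in I$; (3) $s(a')=1-s(a)$ for every $a\in B$.
   Context: An involutive bisemilattice is an algebra $\mathbf B=\langle B,\wedge,\vee,',0,1\rangle$ of type $(2,2,1,0,0)$ satisfying $x\vee x\approx x$, $x\vee y\approx y\vee x$, $x\vee(y\vee z)\approx(x\vee y)\vee z$, $(x')'\approx x$, $x\wedge y\approx(x'\vee y')'$, $x\wedge(x'\vee y)\approx x\wedge y$, $0\vee x\approx x$, $1\approx 0'$. Every involutive bisemilattice is (canonically) the Płonka sum of a semilattice direct system of Boolean algebras, and $\mathbf B$ is identified with it: there is a join-semilattice $(I,\vee)$ with least element $i_0$ (ordered by $i\le j$ iff $i\vee j=j$), Boolean algebras $\mathbf A_i$ ($i\in I$) with pairwise disjoint universes, and Boolean homomorphisms $p_{ij}\colon\mathbf A_i\to\mathbf A_j$ for $i\le j$, with $p_{ii}=\mathrm{id}$ and $p_{ik}=p_{jk}\circ p_{ij}$ for $i\le j\le k$, such that $B=\bigsqcup_{i\in I}A_i$; for $a\in A_i$, $b\in A_j$ and $k=i\vee j$, $a\wedge b=p_{ik}(a)\wedge^{\mathbf A_k}p_{jk}(b)$ and $a\vee b=p_{ik}(a)\vee^{\mathbf A_k}p_{jk}(b)$; $a'$ is the complement of $a$ in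 the algebra $\mathbf A_i$ containing $a$; and $0,1$ are the bottom and top of $\mathbf A_{i_0}$. We write $0_i,1_i$ for the bottom and top elements of $\mathbf A_i$. A state over $\mathbf B$ is a map $s\colon B\to[0,1]$ such that $s(1)=1$ and $s(a\vee b)=s(a)+s(b)$ whenever $a\wedge b\in\{0_i:i\in I\}$. -}

module Defs where

open import Level using (0ℓ)
open import Data.Product using (Σ; _×_; _,_; proj₁; proj₂)
open import Relation.Nullary using (¬_)
open import Relation.Binary.Core using (Rel)
open import Relation.Binary.Structures using (IsTotalOrder)
open import Relation.Binary.PropositionalEquality using (_≡_; refl; sym; trans; cong)
open import Algebra.Bundles using (CommutativeRing)
open import Algebra.Lattice.Bundles using (BooleanAlgebra)

-- The real numbers, axiomatised as a complete ordered field
-- (any model is isomorphic to ℝ).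

record RealNumbers : Set₁ where
  field
    commRing : CommutativeRing 0ℓ 0ℓ
  open CommutativeRing commRing public
  infix 4 _≤_
  field
    _≤_          : Rel Carrier 0ℓ
    isTotalOrder : IsTotalOrder _≈_ _≤_
    +-mono-≤     : ∀ {x y} z → x ≤ y → x + z ≤ y + z
    *-nonneg     : ∀ {x y} → 0# ≤ x → 0# ≤ y → 0# ≤ x * y
    0≉1          : ¬ (0# ≈ 1#)
    *-inverse    : ∀ x → ¬ (x ≈ 0#) → Σ Carrier (λ y → x * y ≈ 1#)
    complete     : (P : Carrier → Set) → Σ Carrier P →
                   Σ Carrier (λ u → ∀ x → P x → x ≤ u) →
                   Σ Carrier (λ l → (∀ x → P x → x ≤ l) ×
                                    (∀ u → (∀ x → P x → x ≤ u) → l ≤ u))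

module _ (A C : BooleanAlgebra 0ℓ 0ℓ) where
  private
    module A = BooleanAlgebra A
    module C = BooleanAlgebra C

  record IsBooleanHom (f : A.Carrier → C.Carrier) : Set where
    field
      ≈-cong : ∀ {x y} → x A.≈ y → f x C.≈ f y
      ∨-hom  : ∀ x y → f (x A.∨ y) C.≈ (f x C.∨ f y)
      ∧-hom  : ∀ x y → f (x A.∧ y) C.≈ (f x C.∧ f y)
      ¬-hom  : ∀ x → f (A.¬ x) C.≈ C.¬ (f x)
      ⊤-hom  : f A.⊤ C.≈ C.⊤
      ⊥-hom  : f A.⊥ C.≈ C.⊥

record JoinSemilattice₀ : Set₁ where
  infixr 6 _⊔_
  field
    I        : Set
    _⊔_      : I → I → I
    i₀       : I
    ⊔-idem   : ∀ i → i ⊔ i ≡ i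
    ⊔-comm   : ∀ i j → i ⊔ j ≡ j ⊔ i
    ⊔-assoc  : ∀ i j k → (i ⊔ j) ⊔ k ≡ i ⊔ (j ⊔ k)
    i₀-least : ∀ i → i₀ ⊔ i ≡ i

  infix 4 _≼_
  _≼_ : I → I → Set
  i ≼ j = i ⊔ j ≡ j

  ≼-⊔ˡ : ∀ i j → i ≼ i ⊔ j
  ≼-⊔ˡ i j = trans (sym (⊔-assoc i i j)) (cong (_⊔ j) (⊔-idem i))

  ≼-⊔ʳ : ∀ i j → j ≼ i ⊔ j
  ≼-⊔ʳ i j = trans (⊔-comm j (i ⊔ j))
               (trans (⊔-assoc i j j) (cong (i ⊔_) (⊔-idem j)))

record PlonkaSystem : Set₁ where
  field
    semilattice : JoinSemilattice₀
  open JoinSemilattice₀ semilattice public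
  field
    A      : I → BooleanAlgebra 0ℓ 0ℓ
  module Alg (i : I) = BooleanAlgebra (A i)
  field
    p      : ∀ {i j} → i ≼ j → Alg.Carrier i → Alg.Carrier j
    p-hom  : ∀ {i j} (h : i ≼ j) → IsBooleanHom (A i) (A j) (p h)
    p-id   : ∀ {i} (h : i ≼ i) x → Alg._≈_ i (p h x) x
    p-comp : ∀ {i j k} (hij : i ≼ j) (hjk : j ≼ k) (hik : i ≼ k) x →
             Alg._≈_ k (p hik x) (p hjk (p hij x))

  B : Set
  B = Σ I Alg.Carrier

  infix 4 _≈B_
  data _≈B_ : B → B → Set where
    fib : ∀ {i a b} → Alg._≈_ i a b → (i , a) ≈B (i , b)

  infixr 7 _∧B_
  infixr 6 _∨B_
  _∨B_ : B → B → B
  (i , a) ∨B (j , b) =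
    i ⊔ j , Alg._∨_ (i ⊔ j) (p (≼-⊔ˡ i j) a) (p (≼-⊔ʳ i j) b)

  _∧B_ : B → B → B
  (i , a) ∧B (j , b) =
    i ⊔ j , Alg._∧_ (i ⊔ j) (p (≼-⊔ˡ i j) a) (p (≼-⊔ʳ i j) b)

  _′ : B → B
  (i , a) ′ = i , Alg.¬_ i a

  zeroᵢ : I → B
  zeroᵢ i = i , Alg.⊥ i

  oneᵢ : I → B
  oneᵢ i = i , Alg.⊤ i

  0B : B
  0B = zeroᵢ i₀

  1B : B
  1B = oneᵢ i₀

record IsState (ℝ : RealNumbers) (S : PlonkaSystem) (s : PlonkaSystem.B S → RealNumbers.Carrier ℝ) : Set where
  open RealNumbers ℝ
  open PlonkaSystem S using (I; _≈B_; _∧B_; _∨B_; zeroᵢ; 1B)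
  field
    s-cong     : ∀ {a b} → a ≈B b → s a ≈ s b
    s-range    : ∀ a → (0# ≤ s a) × (s a ≤ 1#)
    s-one      : s 1B ≈ 1#
    s-additive : ∀ a b → Σ I (λ i → (a ∧B b) ≈B zeroᵢ i) → s (a ∨B b) ≈ s a + s b

module Submission where

-- The argument has an algebraic half and an arithmetic half.
--   * Płonka-sum identities (module PlonkaSum): joining with 0ⱼ just lifts an
--     element to the fibre i ⊔ j, meeting with 0ⱼ gives 0_{i⊔j}, and a ∨ a′,
--     a ∧ a′ are the top and bottom of the fibre i ⊔ i.  All of them follow
--     from the transition maps being Boolean homomorphisms; for the
--     complement laws we also need that pᵢⱼ does not depend on the proof of
--     i ≼ j.  Every meet above is some 0ₖ, so additivity of s applies.
--   * States (module State): additivity on 0ᵢ ∨ 0ᵢ = 0ᵢ gives s(0ᵢ) = s(0ᵢ) + s(0ᵢ),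
--     so s(0ᵢ) = 0; then 1 ∨ 0ᵢ = 1ᵢ gives s(1ᵢ) = 1, and a ∨ a′ = 1ᵢ gives
--     s(a) + s(a′) = 1.  The cancellations are group laws of (ℝ, +, 0).

open import Defs
open import Data.Product using (_×_; _,_)
open import Function using (_∘_)
open import Relation.Binary.PropositionalEquality as P using (_≡_)
import Algebra.Lattice.Properties.BooleanAlgebra as BooleanAlgebraProperties
import Algebra.Properties.Group as GroupProperties
import Relation.Binary.Reasoning.Setoid as SetoidReasoning

module PlonkaSum (S : PlonkaSystem) where
  open PlonkaSystem S

  module Fibre (i : I) where
    open Alg i public
    open BooleanAlgebraProperties (A i) public using (∨-identityʳ; ∧-zeroʳ)

  module Hom {i j} (h : i ≼ j) = IsBooleanHom (p-hom h)

  ≈B-trans : ∀ {a b c} → a ≈B b → b ≈B c → a ≈B c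
  ≈B-trans {i , _} (fib e) (fib e′) = fib (Fibre.trans i e e′)

  -- The transition map pᵢⱼ depends only on i and j, not on the proof of i ≼ j;
  -- by p-comp both maps factor through pᵢᵢ, which is the identity.
  p-irrelevant : ∀ {i j} (h h′ : i ≼ j) x → Fibre._≈_ j (p h x) (p h′ x)
  p-irrelevant {i} {j} h h′ x = begin
      p h x                 ≈⟨ p-comp (⊔-idem i) h′ h x ⟩
      p h′ (p (⊔-idem i) x) ≈⟨ Hom.≈-cong h′ (p-id (⊔-idem i) x) ⟩
      p h′ x                ∎
    where open SetoidReasoning (Fibre.setoid j)

  ∨B-zeroᵢ : ∀ {i} j x → (i , x) ∨B zeroᵢ j ≈B (i ⊔ j , p (≼-⊔ˡ i j) x)
  ∨B-zeroᵢ {i} j x = fib (trans (∨-congˡ (Hom.⊥-hom (≼-⊔ʳ i j))) (∨-identityʳ _))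
    where open Fibre (i ⊔ j)

  ∧B-zeroᵢ : ∀ {i} j x → (i , x) ∧B zeroᵢ j ≈B zeroᵢ (i ⊔ j)
  ∧B-zeroᵢ {i} j x = fib (trans (∧-congˡ (Hom.⊥-hom (≼-⊔ʳ i j))) (∧-zeroʳ _))
    where open Fibre (i ⊔ j)

  lifted-¬ : ∀ i x →
             Fibre._≈_ (i ⊔ i) (p (≼-⊔ʳ i i) (Fibre.¬_ i x))
                               (Fibre.¬_ (i ⊔ i) (p (≼-⊔ˡ i i) x))
  lifted-¬ i x = Fibre.trans (i ⊔ i) (p-irrelevant (≼-⊔ʳ i i) (≼-⊔ˡ i i) _)
                                     (Hom.¬-hom (≼-⊔ˡ i i) x)

  ∨B-complement : ∀ i x → (i , x) ∨B (i , x) ′ ≈B oneᵢ (i ⊔ i)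
  ∨B-complement i x = fib (trans (∨-congˡ (lifted-¬ i x)) (∨-complementʳ _))
    where open Fibre (i ⊔ i)

  ∧B-complement : ∀ i x → (i , x) ∧B (i , x) ′ ≈B zeroᵢ (i ⊔ i)
  ∧B-complement i x = fib (trans (∧-congˡ (lifted-¬ i x)) (∧-complementʳ _))
    where open Fibre (i ⊔ i)

  zeroᵢ-∨B-zeroᵢ : ∀ i j → zeroᵢ i ∨B zeroᵢ j ≈B zeroᵢ (i ⊔ j)
  zeroᵢ-∨B-zeroᵢ i j = ≈B-trans (∨B-zeroᵢ j _) (fib (Hom.⊥-hom (≼-⊔ˡ i j)))

  oneᵢ-∨B-zeroᵢ : ∀ i j → oneᵢ i ∨B zeroᵢ j ≈B oneᵢ (i ⊔ j)
  oneᵢ-∨B-zeroᵢ i j = ≈B-trans (∨B-zeroᵢ j _) (fib (Hom.⊤-hom (≼-⊔ˡ i j)))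

module State (ℝ : RealNumbers) (S : PlonkaSystem)
             (s : PlonkaSystem.B S → RealNumbers.Carrier ℝ) (st : IsState ℝ S s) where
  open RealNumbers ℝ
  open GroupProperties +-group using (identityʳ-unique; x≈z//y)
  open PlonkaSystem S
  open PlonkaSum S
  open IsState st
  open SetoidReasoning setoid

  s-⊔-idem : (c : I → B) (i : I) → s (c (i ⊔ i)) ≈ s (c i)
  s-⊔-idem c i = reflexive (P.cong (s ∘ c) (⊔-idem i))

  -- s(0ᵢ) = 0, because s(0ᵢ) + s(0ᵢ) = s(0ᵢ ∨ 0ᵢ) = s(0ᵢ).
  state-zeroᵢ : ∀ i → s (zeroᵢ i) ≈ 0#
  state-zeroᵢ i = identityʳ-unique (s (zeroᵢ i)) (s (zeroᵢ i)) (begin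
      s (zeroᵢ i) + s (zeroᵢ i) ≈⟨ s-additive (zeroᵢ i) (zeroᵢ i) (i ⊔ i , ∧B-zeroᵢ i _) ⟨
      s (zeroᵢ i ∨B zeroᵢ i)    ≈⟨ s-cong (zeroᵢ-∨B-zeroᵢ i i) ⟩
      s (zeroᵢ (i ⊔ i))         ≈⟨ s-⊔-idem zeroᵢ i ⟩
      s (zeroᵢ i)               ∎)

  -- s(1ᵢ) = 1, because 1ᵢ = 1 ∨ 0ᵢ with 1 ∧ 0ᵢ = 0ᵢ.
  state-oneᵢ : ∀ i → s (oneᵢ i) ≈ 1#
  state-oneᵢ i = begin
      s (oneᵢ i)           ≈⟨ reflexive (P.cong (s ∘ oneᵢ) (i₀-least i)) ⟨
      s (oneᵢ (i₀ ⊔ i))    ≈⟨ s-cong (oneᵢ-∨B-zeroᵢ i₀ i) ⟨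
      s (1B ∨B zeroᵢ i)    ≈⟨ s-additive 1B (zeroᵢ i) (i₀ ⊔ i , ∧B-zeroᵢ i _) ⟩
      s 1B + s (zeroᵢ i)   ≈⟨ +-cong s-one (state-zeroᵢ i) ⟩
      1# + 0#              ≈⟨ +-identityʳ 1# ⟩
      1#                   ∎

  -- s(a′) = 1 − s(a), because s(a′) + s(a) = s(a ∨ a′) = s(1ᵢ) = 1.
  state-complement : ∀ a → s (a ′) ≈ 1# + (- s a)
  state-complement a@(i , x) = x≈z//y (s (a ′)) (s a) 1# (begin
      s (a ′) + s a        ≈⟨ +-comm (s (a ′)) (s a) ⟩
      s a + s (a ′)        ≈⟨ s-additive a (a ′) (i ⊔ i , ∧B-complement i x) ⟨
      s (a ∨B a ′)         ≈⟨ s-cong (∨B-complement i x) ⟩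
      s (oneᵢ (i ⊔ i))     ≈⟨ s-⊔-idem oneᵢ i ⟩
      s (oneᵢ i)           ≈⟨ state-oneᵢ i ⟩
      1#                   ∎)

proposition3p2 : (ℝ : RealNumbers) (S : PlonkaSystem) (s : PlonkaSystem.B S → RealNumbers.Carrier ℝ) →
    IsState ℝ S s →
    let open RealNumbers ℝ in
    let open PlonkaSystem S in
    (s 0B ≈ 0#)
    × (∀ i → (s (oneᵢ i) ≈ 1#) × (s (zeroᵢ i) ≈ 0#))
    × (∀ a → s (a ′) ≈ 1# + (- s a))
proposition3p2 ℝ S s st =
  state-zeroᵢ _ , (λ i → state-oneᵢ i , state-zeroᵢ i) , state-complement
  where open State ℝ S s st
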